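{- Let $\ell>0$ and $n\ge 4\ell$ be integers, and let $G$ be a graph of diameter two such that for every $v\in V(G)$, the neighborhood of $v$ contains no independent set of size $3$. Then there exists a globally $(4\ell)$-bounded edge-coloring $c$ of $K_n$, with $V(K_n)=\{1,\dots,n\}$, such that every copy of $G$ in $K_n$ that is rainbow in $c$ contains at most $3$ vertices from the set $\{1,\dots,4\ell\}$.
   Context: An edge-coloring $c$ of $E(K_n)$ is globally $k$-bounded if no color appears on more than $k$ edges of $K_n$. A copy of $G$ is rainbow in $c$ if no two of its edges have the same color. A graph has diameter two if any two distinct vertices are adjacent or have a common neighbor, and it is not complete. -}

module Defs where

open import Data.Nat using (ℕ; _<_; _≤_; _<?_)
open import Data.Nat.Properties using (_≟_)
open import Data.Fin using (Fin; toℕ)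
open import Data.List using (List; length; filter; concatMap; map; allFin)
open import Data.Product using (Σ; _×_; _,_; proj₁; proj₂)
open import Data.Sum using (_⊎_)
open import Relation.Nullary using (¬_; Dec)
open import Relation.Binary.PropositionalEquality using (_≡_)
open import Function.Definitions using (Injective)

record Graph : Set₁ where
  field
    order : ℕ
    Adj   : Fin order → Fin order → Set
    adj?  : (u v : Fin order) → Dec (Adj u v)
    sym   : ∀ {u v} → Adj u v → Adj v u
    irrefl : ∀ {u} → ¬ Adj u u

open Graph public

IsComplete : Graph → Set
IsComplete G = ∀ (u v : Fin (order G)) → ¬ u ≡ v → Adj G u v

DiameterTwo : Graph → Set
DiameterTwo G =
  (∀ (u v : Fin (order G)) → ¬ u ≡ v →
     Adj G u v ⊎ Σ (Fin (order G)) (λ w → Adj G u w × Adj G w v))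
  × ¬ IsComplete G

NbhdNoIndep3 : Graph → Set
NbhdNoIndep3 G = ∀ (v a b c : Fin (order G)) →
  Adj G v a → Adj G v b → Adj G v c →
  ¬ a ≡ b → ¬ a ≡ c → ¬ b ≡ c →
  ¬ (¬ Adj G a b × ¬ Adj G a c × ¬ Adj G b c)

-- Edge colourings of K_n (vertices Fin n, i.e. 0..n-1 standing for 1..n), colours in ℕ;
-- a colouring is a symmetric function on pairs (diagonal values are irrelevant).
Colouring : ℕ → Set
Colouring n = Fin n → Fin n → ℕ

SymmetricColouring : ∀ {n} → Colouring n → Set
SymmetricColouring {n} c = ∀ (i j : Fin n) → c i j ≡ c j i

edgesK : (n : ℕ) → List (Fin n × Fin n)
edgesK n = filter (λ p → toℕ (proj₁ p) <? toℕ (proj₂ p))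
                  (concatMap (λ i → map (λ j → (i , j)) (allFin n)) (allFin n))

colourCount : ∀ {n} → Colouring n → ℕ → ℕ
colourCount {n} c a = length (filter (λ p → c (proj₁ p) (proj₂ p) ≟ a) (edgesK n))

GloballyBounded : ∀ {n} → ℕ → Colouring n → Set
GloballyBounded k c = ∀ (a : ℕ) → colourCount c a ≤ k

-- A copy of G in K_n is an injective map f : V(G) → V(K_n); it is rainbow if
-- two edges of G receive the same colour only if they are the same edge.
Rainbow : ∀ {n} (G : Graph) → Colouring n → (Fin (order G) → Fin n) → Set
Rainbow G c f = ∀ (u v u' v' : Fin (order G)) → Adj G u v → Adj G u' v' →
  c (f u) (f v) ≡ c (f u') (f v') → (u ≡ u' × v ≡ v') ⊎ (u ≡ v' × v ≡ u')

-- Number of vertices of the copy lying in {1,…,k} (i.e. Fin-index < k).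
verticesBelow : ∀ {n} (G : Graph) → (Fin (order G) → Fin n) → ℕ → ℕ
verticesBelow G f k = length (filter (λ u → toℕ (f u) <? k) (allFin (order G)))

module Submission where

-- Let K = 4ℓ.  An edge {i , j} with i < j and i ∈ B receives the
-- colour j (its upper end); every other edge receives its own private colour
-- n + code(i , j).  A colour j < n is then used only by edges {i , j} with i ∈ B,
-- so by at most K edges, and a colour ≥ n by at most one edge.
--
-- In a rainbow copy, order the vertices of G by their
-- images ("heights").  All edges from a vertex down into B share one colour, so
-- every vertex has at most one lower neighbour in B; in particular B spans no
-- triangle.  Let a be the highest vertex of the copy in B.  Every other vertex of
-- the copy in B is either a neighbour of a (there is at most one, being a lower
-- neighbour) or a non-neighbour of a.  Two non-neighbours p , q both share with a
-- a common neighbour, necessarily the unique lower neighbour w of a in B; then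
-- {a , p , q} ⊆ N(w) is independent unless p q is an edge, and then w p q is a
-- triangle in B.  Hence there is at most one non-neighbour, and at most three
-- vertices of the copy lie in B.

open import Defs hiding (sym)
open import Data.Nat using (ℕ; _+_; _*_; _<_; _≤_; _<?_; z≤n; s≤s; z<s)
open import Data.Nat.Properties
  using (_≟_; <-asym; <-trans; ≤-trans; ≤-antisym; <-≤-trans; ≤-<-trans; <-cmp;
         ≮⇒≥; ≤⇒≯; ≤∧≢⇒<; m≤m+n; m≤n*m; +-cancelˡ-≡)
open import Data.Fin using (Fin; toℕ; fromℕ<; combine)
import Data.Fin.Properties as Fin
open import Data.Product using (Σ; _×_; _,_; proj₁; proj₂)
open import Data.Product.Properties using (×-≡,≡→≡)
open import Data.Sum using (_⊎_; inj₁; inj₂)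
open import Data.Empty using (⊥; ⊥-elim)
open import Data.List using (List; []; _∷_; length; filter; concatMap; map; allFin; lookup; _++_; cartesianProduct)
open import Data.List.Relation.Unary.All as All using (All; _∷_)
open import Data.List.Relation.Unary.All.Properties using (all-filter)
open import Data.List.Relation.Unary.AllPairs using (_∷_)
open import Data.List.Relation.Unary.Any using (here; there)
open import Data.List.Relation.Unary.Unique.Propositional using (Unique)
import Data.List.Relation.Unary.Unique.Propositional.Properties as Unique
open import Data.List.Membership.Propositional using (_∈_)
open import Data.List.Membership.Propositional.Properties using (∈-filter⁻; ∈-lookup)
open import Data.List.Extrema.Nat using (argmax; argmax-all; f[⊥]≤f[argmax]; f[xs]≤f[argmax])
open import Function using (_∘_)
open import Function.Definitions using (Injective)
open import Relation.Nullary using (¬_; Dec; yes; no; contradiction)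
open import Relation.Binary using (tri<; tri≈; tri>)
open import Relation.Binary.PropositionalEquality using (_≡_; _≢_; refl; sym; trans; cong; subst; module ≡-Reasoning)

lookup-injective : ∀ {A : Set} {xs : List A} → Unique xs →
  ∀ i j → lookup xs i ≡ lookup xs j → i ≡ j
lookup-injective (_ ∷ _)      Fin.zero    Fin.zero    _  = refl
lookup-injective (x∉xs ∷ _)   Fin.zero    (Fin.suc j) eq =
  contradiction eq (All.lookup x∉xs (∈-lookup j))
lookup-injective (x∉xs ∷ _)   (Fin.suc i) Fin.zero    eq =
  contradiction (sym eq) (All.lookup x∉xs (∈-lookup i))
lookup-injective (_ ∷ unique) (Fin.suc i) (Fin.suc j) eq = cong Fin.suc (lookup-injective unique i j eq)

length≤#labels : ∀ {A : Set} {xs : List A} (m : ℕ) (label : A → ℕ) → Unique xs →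
  (∀ {x} → x ∈ xs → label x < m) →
  (∀ {x y} → x ∈ xs → y ∈ xs → label x ≡ label y → x ≡ y) →
  length xs ≤ m
length≤#labels {xs = xs} m label unique bounded separating = ≮⇒≥ tooLong⇒⊥
  where
    slot : Fin (length xs) → Fin m
    slot i = fromℕ< (bounded (∈-lookup i))

    sameSlot⇒sameLabel : ∀ {i j} → slot i ≡ slot j → label (lookup xs i) ≡ label (lookup xs j)
    sameSlot⇒sameLabel eq = trans (sym (Fin.toℕ-fromℕ< _)) (trans (cong toℕ eq) (Fin.toℕ-fromℕ< _))

    tooLong⇒⊥ : ¬ m < length xs
    tooLong⇒⊥ m<len with Fin.pigeonhole m<len slot
    ... | i , j , i<j , eq = Fin.<-irrefl
      (lookup-injective unique i j (separating (∈-lookup i) (∈-lookup j) (sameSlot⇒sameLabel eq))) i<j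

edgeColour : (n K : ℕ) → Fin n → Fin n → ℕ
edgeColour n K i j with toℕ i <? K
... | yes _ = toℕ j
... | no _  = n + toℕ (combine i j)

blockColouring : (n K : ℕ) → Colouring n
blockColouring n K i j with toℕ i <? toℕ j
... | yes _ = edgeColour n K i j
... | no _  = edgeColour n K j i

blockColouring-symmetric : ∀ n K → SymmetricColouring (blockColouring n K)
blockColouring-symmetric n K i j with toℕ i <? toℕ j | toℕ j <? toℕ i
... | yes i<j | yes j<i = contradiction j<i (<-asym i<j)
... | yes _   | no _    = refl
... | no _    | yes _   = refl
... | no i≮j  | no j≮i with Fin.toℕ-injective (≤-antisym (≮⇒≥ j≮i) (≮⇒≥ i≮j))
...   | refl = refl

blockColouring-ordered : ∀ {n K} {i j : Fin n} → toℕ i < toℕ j →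
  blockColouring n K i j ≡ edgeColour n K i j
blockColouring-ordered {i = i} {j} i<j with toℕ i <? toℕ j
... | yes _   = refl
... | no i≮j = contradiction i<j i≮j

edgeColour-cases : ∀ n K (i j : Fin n) →
  (toℕ i < K × edgeColour n K i j ≡ toℕ j) ⊎ (edgeColour n K i j ≡ n + toℕ (combine i j))
edgeColour-cases n K i j with toℕ i <? K
... | yes i<K = inj₁ (i<K , refl)
... | no _    = inj₂ refl

edgeColour-low : ∀ {n K} {i j : Fin n} → toℕ i < K → edgeColour n K i j ≡ toℕ j
edgeColour-low {K = K} {i} i<K with toℕ i <? K
... | yes _   = refl
... | no i≮K = contradiction i<K i≮K

downColour : ∀ {n K} {i j : Fin n} → toℕ i < toℕ j → toℕ i < K →
  blockColouring n K j i ≡ toℕ j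
downColour {n} {K} {i} {j} i<j i<K = begin
  blockColouring n K j i ≡⟨ blockColouring-symmetric n K j i ⟩
  blockColouring n K i j ≡⟨ blockColouring-ordered i<j ⟩
  edgeColour n K i j     ≡⟨ edgeColour-low i<K ⟩
  toℕ j                  ∎
  where open ≡-Reasoning

concatMap-pairs : ∀ {n} (xs ys : List (Fin n)) →
  concatMap (λ i → map (λ j → (i , j)) ys) xs ≡ cartesianProduct xs ys
concatMap-pairs []       ys = refl
concatMap-pairs (x ∷ xs) ys = cong (map (λ j → (x , j)) ys ++_) (concatMap-pairs xs ys)

edgesK-unique : ∀ n → Unique (edgesK n)
edgesK-unique n = Unique.filter⁺ _
  (subst Unique (sym (concatMap-pairs (allFin n) (allFin n)))
    (Unique.cartesianProduct⁺ (Unique.allFin⁺ n) (Unique.allFin⁺ n)))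

edgesK-ordered : ∀ {n} {e : Fin n × Fin n} → e ∈ edgesK n → toℕ (proj₁ e) < toℕ (proj₂ e)
edgesK-ordered {n} e∈ = proj₂ (∈-filter⁻ (λ e → toℕ (proj₁ e) <? toℕ (proj₂ e))
  {xs = concatMap (λ i → map (λ j → (i , j)) (allFin n)) (allFin n)} e∈)

module ColourClass (n K a : ℕ) where

  hasColour : (e : Fin n × Fin n) → Dec (blockColouring n K (proj₁ e) (proj₂ e) ≡ a)
  hasColour e = blockColouring n K (proj₁ e) (proj₂ e) ≟ a

  edges : List (Fin n × Fin n)
  edges = filter hasColour (edgesK n)

  edges-unique : Unique edges
  edges-unique = Unique.filter⁺ hasColour (edgesK-unique n)

  memberColour : ∀ {i j} → (i , j) ∈ edges → edgeColour n K i j ≡ a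
  memberColour e∈ with ∈-filter⁻ hasColour {xs = edgesK n} e∈
  ... | e∈K , colour≡a = trans (sym (blockColouring-ordered (edgesK-ordered e∈K))) colour≡a

  lowColour : ∀ {i j} → (i , j) ∈ edges → a < n → toℕ i < K × toℕ j ≡ a
  lowColour {i} {j} e∈ a<n with edgeColour-cases n K i j
  ... | inj₁ (i<K , colour≡j) = i<K , trans (sym colour≡j) (memberColour e∈)
  ... | inj₂ colour≡big = contradiction a<n (≤⇒≯ (subst (n ≤_) big≡a (m≤m+n n _)))
    where
      big≡a : n + toℕ (combine i j) ≡ a
      big≡a = trans (sym colour≡big) (memberColour e∈)

  highColour : ∀ {i j} → (i , j) ∈ edges → ¬ a < n → n + toℕ (combine i j) ≡ a
  highColour {i} {j} e∈ a≮n with edgeColour-cases n K i j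
  ... | inj₁ (_ , colour≡j) =
    contradiction (subst (_< n) (trans (sym colour≡j) (memberColour e∈)) (Fin.toℕ<n j)) a≮n
  ... | inj₂ colour≡big = trans (sym colour≡big) (memberColour e∈)

-- Each colour is used at most K times: a colour a < n labels its edges injectively
-- by their lower ends in the block, and a colour ≥ n is used by one edge only.
blockColouring-bounded : ∀ n K → 0 < K → GloballyBounded K (blockColouring n K)
blockColouring-bounded n K K>0 a with a <? n
... | yes a<n = length≤#labels K (toℕ ∘ proj₁) edges-unique
      (λ e∈ → proj₁ (lowColour e∈ a<n)) sameLowerEnd
  where
    open ColourClass n K a
    sameLowerEnd : ∀ {e e'} → e ∈ edges → e' ∈ edges → toℕ (proj₁ e) ≡ toℕ (proj₁ e') → e ≡ e'
    sameLowerEnd e∈ e'∈ i≡i' = ×-≡,≡→≡ (Fin.toℕ-injective i≡i' ,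
      Fin.toℕ-injective (trans (proj₂ (lowColour e∈ a<n)) (sym (proj₂ (lowColour e'∈ a<n)))))
... | no a≮n = ≤-trans (length≤#labels 1 (λ _ → 0) edges-unique (λ _ → z<s) samePair) K>0
  where
    open ColourClass n K a
    samePair : ∀ {e e'} → e ∈ edges → e' ∈ edges → 0 ≡ 0 → e ≡ e'
    samePair {i , j} {i' , j'} e∈ e'∈ _ = ×-≡,≡→≡ (Fin.combine-injective i j i' j'
      (Fin.toℕ-injective (+-cancelˡ-≡ n _ _ (trans (highColour e∈ a≮n) (sym (highColour e'∈ a≮n))))))

-- In a rainbow copy f, the edges from a vertex x down into the block all have the
-- colour of f x, so x has at most one lower neighbour in the block.
rainbow-lowerNeighbourUnique : ∀ {n K} (G : Graph) (f : Fin (order G) → Fin n) →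
  Rainbow G (blockColouring n K) f →
  ∀ {x s t} → Adj G x s → Adj G x t → toℕ (f s) < K → toℕ (f t) < K →
  toℕ (f s) < toℕ (f x) → toℕ (f t) < toℕ (f x) → s ≡ t
rainbow-lowerNeighbourUnique G f rainbow {x} {s} {t} xs xt s<K t<K s<x t<x
  with rainbow x s x t xs xt (trans (downColour s<x s<K) (sym (downColour t<x t<K)))
... | inj₁ (_ , s≡t)     = s≡t
... | inj₂ (x≡t , s≡x) = trans s≡x x≡t

module BlockBound (G : Graph) (diameterTwo : DiameterTwo G) (noIndep3 : NbhdNoIndep3 G)
  (h : Fin (order G) → ℕ) (h-injective : Injective _≡_ _≡_ h) (K : ℕ)
  (lowerNeighbourUnique : ∀ {x s t} → Adj G x s → Adj G x t → h s < K → h t < K →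
                          h s < h x → h t < h x → s ≡ t) where

  V : Set
  V = Fin (order G)

  InBlock : V → Set
  InBlock x = h x < K

  adjacent⇒distinct : ∀ {x y} → Adj G x y → x ≢ y
  adjacent⇒distinct xy refl = Graph.irrefl G xy

  -- The block spans no triangle: its highest vertex would have two lower
  -- neighbours in the block.
  noBlockTriangle : ∀ {x y z} → InBlock x → InBlock y → InBlock z →
    Adj G x y → Adj G y z → Adj G x z → ⊥
  noBlockTriangle {x} {y} {z} Bx By Bz xy yz xz
    with <-cmp (h x) (h y) | <-cmp (h y) (h z) | <-cmp (h z) (h x)
  ... | tri≈ _ x≡y _ | _ | _ = adjacent⇒distinct xy (h-injective x≡y)
  ... | _ | tri≈ _ y≡z _ | _ = adjacent⇒distinct yz (h-injective y≡z)
  ... | _ | _ | tri≈ _ z≡x _ = adjacent⇒distinct xz (sym (h-injective z≡x))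
  ... | tri> _ _ y<x | _ | tri< z<x _ _ =
    adjacent⇒distinct yz (lowerNeighbourUnique xy xz By Bz y<x z<x)
  ... | tri< x<y _ _ | tri> _ _ z<y | _ =
    adjacent⇒distinct xz (lowerNeighbourUnique (Graph.sym G xy) yz Bx Bz x<y z<y)
  ... | _ | tri< y<z _ _ | tri> _ _ x<z =
    adjacent⇒distinct xy (lowerNeighbourUnique (Graph.sym G xz) (Graph.sym G yz) Bx By x<z y<z)
  ... | tri< x<y _ _ | tri< y<z _ _ | tri< z<x _ _ = <-asym (<-trans x<y y<z) z<x
  ... | tri> _ _ y<x | tri> _ _ z<y | tri> _ _ x<z = <-asym (<-trans z<y y<x) x<z

  -- Vertices dominated by a (not higher than a) lie in the
  -- block, and relative to a each is a itself, a neighbour or a non-neighbour;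
  -- there is at most one dominated vertex of each kind.
  module RelativeTo (a : V) (Ba : InBlock a) where

    Dominated : V → Set
    Dominated y = h y ≤ h a

    dominated⇒inBlock : ∀ {y} → Dominated y → InBlock y
    dominated⇒inBlock y≤a = ≤-<-trans y≤a Ba

    strictlyBelow : ∀ {y} → Dominated y → y ≢ a → h y < h a
    strictlyBelow y≤a y≢a = ≤∧≢⇒< y≤a (y≢a ∘ h-injective)

    neighboursCoincide : ∀ {s t} → Adj G a s → Adj G a t → Dominated s → Dominated t → s ≡ t
    neighboursCoincide as at s≤a t≤a = lowerNeighbourUnique as at
      (dominated⇒inBlock s≤a) (dominated⇒inBlock t≤a)
      (strictlyBelow s≤a (adjacent⇒distinct as ∘ sym)) (strictlyBelow t≤a (adjacent⇒distinct at ∘ sym))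

    -- A dominated non-neighbour p of a has a common neighbour with a, and that
    -- neighbour is dominated too: above a it would have the two lower block
    -- neighbours a and p.
    commonNeighbour : ∀ {p} → Dominated p → p ≢ a → ¬ Adj G a p →
      Σ V (λ w → Adj G a w × Adj G w p × Dominated w)
    commonNeighbour {p} p≤a p≢a ¬ap with proj₁ diameterTwo a p (p≢a ∘ sym)
    ... | inj₁ ap = contradiction ap ¬ap
    ... | inj₂ (w , aw , wp) = w , aw , wp , ≮⇒≥ aBelow⇒⊥
      where
        aBelow⇒⊥ : ¬ h a < h w
        aBelow⇒⊥ a<w = p≢a (sym (lowerNeighbourUnique (Graph.sym G aw) wp
          Ba (dominated⇒inBlock p≤a) a<w (≤-<-trans p≤a a<w)))

    -- Two dominated non-neighbours p , q of a share the common neighbour w with a;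
    -- if p ≢ q then {a , p , q} ⊆ N(w) is independent or w p q is a block triangle.
    nonNeighboursCoincide : ∀ {p q} → Dominated p → Dominated q → p ≢ a → q ≢ a →
      ¬ Adj G a p → ¬ Adj G a q → p ≡ q
    nonNeighboursCoincide {p} {q} p≤a q≤a p≢a q≢a ¬ap ¬aq
      with commonNeighbour p≤a p≢a ¬ap | commonNeighbour q≤a q≢a ¬aq
    ... | w , aw , wp , w≤a | w' , aw' , w'q , w'≤a
      with neighboursCoincide aw aw' w≤a w'≤a
    ... | refl with p Fin.≟ q
    ...   | yes p≡q = p≡q
    ...   | no p≢q with Graph.adj? G p q
    ...     | yes pq = ⊥-elim (noBlockTriangle (dominated⇒inBlock w≤a)
                          (dominated⇒inBlock p≤a) (dominated⇒inBlock q≤a) wp pq w'q)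
    ...     | no ¬pq = ⊥-elim (noIndep3 w a p q (Graph.sym G aw) wp w'q
                          (p≢a ∘ sym) (q≢a ∘ sym) p≢q (¬ap , ¬aq , ¬pq))

    position : V → ℕ
    position y with y Fin.≟ a | Graph.adj? G a y
    ... | yes _ | _     = 0
    ... | no _  | yes _ = 1
    ... | no _  | no _  = 2

    position<3 : ∀ y → position y < 3
    position<3 y with y Fin.≟ a | Graph.adj? G a y
    ... | yes _ | _     = s≤s z≤n
    ... | no _  | yes _ = s≤s (s≤s z≤n)
    ... | no _  | no _  = s≤s (s≤s (s≤s z≤n))

    position-injective : ∀ {x y} → Dominated x → Dominated y → position x ≡ position y → x ≡ y
    position-injective {x} {y} x≤a y≤a same
      with x Fin.≟ a | Graph.adj? G a x | y Fin.≟ a | Graph.adj? G a y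
    ... | yes x≡a | _      | yes y≡a | _      = trans x≡a (sym y≡a)
    ... | no _    | yes ax | no _    | yes ay = neighboursCoincide ax ay x≤a y≤a
    ... | no x≢a  | no ¬ax | no y≢a  | no ¬ay = nonNeighboursCoincide x≤a y≤a x≢a y≢a ¬ax ¬ay
    ... | yes _   | _      | no _    | yes _  with () ← same
    ... | yes _   | _      | no _    | no _   with () ← same
    ... | no _    | yes _  | yes _   | _      with () ← same
    ... | no _    | yes _  | no _    | no _   with () ← same
    ... | no _    | no _   | yes _   | _      with () ← same
    ... | no _    | no _   | no _    | yes _  with () ← same

  -- A duplicate-free list of block vertices has at most three entries: relative
  -- to its highest entry, distinct entries have distinct positions.
  atMostThreeInBlock : ∀ {ys} → Unique ys → All InBlock ys → length ys ≤ 3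
  atMostThreeInBlock {[]}     _      _          = z≤n
  atMostThreeInBlock {y ∷ ys} unique (By ∷ Bys) =
    length≤#labels 3 position unique (λ {x} _ → position<3 x)
      (λ x∈ x'∈ → position-injective (dominated x∈) (dominated x'∈))
    where
      open RelativeTo (argmax h y ys) (argmax-all h By Bys)
      dominated : ∀ {x} → x ∈ y ∷ ys → Dominated x
      dominated (here refl) = f[⊥]≤f[argmax] {f = h} y ys
      dominated (there x∈)  = All.lookup (f[xs]≤f[argmax] {f = h} y ys) x∈

  blockSize≤3 : length (filter (λ x → h x <? K) (allFin (order G))) ≤ 3
  blockSize≤3 = atMostThreeInBlock (Unique.filter⁺ _ (Unique.allFin⁺ _)) (all-filter _ (allFin _))

lemma4p4 : (ℓ n : ℕ) → 0 < ℓ → 4 * ℓ ≤ n →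
    (G : Graph) → DiameterTwo G → NbhdNoIndep3 G →
    Σ (Colouring n) (λ c → SymmetricColouring c × GloballyBounded (4 * ℓ) c ×
      ((f : Fin (order G) → Fin n) → Injective _≡_ _≡_ f → Rainbow G c f →
        verticesBelow G f (4 * ℓ) ≤ 3))
lemma4p4 ℓ n ℓ>0 _ G diameterTwo noIndep3 =
  blockColouring n K , blockColouring-symmetric n K , blockColouring-bounded n K K>0 ,
  rainbowCopyMeetsBlockInAtMostThree
  where
    K : ℕ
    K = 4 * ℓ

    K>0 : 0 < K
    K>0 = <-≤-trans ℓ>0 (m≤n*m ℓ 4)

    rainbowCopyMeetsBlockInAtMostThree : (f : Fin (order G) → Fin n) → Injective _≡_ _≡_ f →
      Rainbow G (blockColouring n K) f → verticesBelow G f K ≤ 3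
    rainbowCopyMeetsBlockInAtMostThree f f-injective rainbow =
      BlockBound.blockSize≤3 G diameterTwo noIndep3 (toℕ ∘ f)
        (f-injective ∘ Fin.toℕ-injective) K (rainbow-lowerNeighbourUnique G f rainbow)
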